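{- Let $q$ be a prime power, $n,k,r$ positive integers, $S$ a $(k-r)$-dimensional and $T$ an $r$-dimensional $\mathbb{F}_q$-subspace of $\mathbb{F}_{q^n}$ with $r\le k-r$, and $U=S\times T$. Then $L_U$ has only two points of weight at least two if and only if $\dim_{\mathbb{F}_q}(a_1S\cap a_2S)=0$ for all $a_1,a_2\in T$ which are $\mathbb{F}_q$-linearly independent.
   Context: For an $\mathbb{F}_q$-subspace $U$ of $\mathbb{F}_{q^n}^2$, $L_U=\{\langle u\rangle_{\mathbb{F}_{q^n}}: u\in U\setminus\{0\}\}\subseteq\mathrm{PG}(1,q^n)$, and the weight of a point $\langle v\rangle_{\mathbb{F}_{q^n}}$ is $\dim_{\mathbb{F}_q}(U\cap\langle v\rangle_{\mathbb{F}_{q^n}})$. $S\times T=\{(s,t):s\in S,t\in T\}$; $aS=\{as:s\in S\}$. -}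

module Defs where

open import Level using (0ℓ)
open import Data.Nat using (ℕ; zero; suc; _≤_; _^_)
open import Data.Nat.Primality using (Prime)
open import Data.Product using (Σ; ∃; _×_; _,_; proj₁; proj₂)
open import Data.Sum using (_⊎_)
open import Data.Vec using (Vec; []; _∷_)
open import Data.Vec.Relation.Unary.All using (All)
open import Data.List using (List; length)
open import Data.List.Membership.Propositional using (_∈_)
open import Data.List.Relation.Unary.Unique.Propositional using (Unique)
open import Relation.Binary.PropositionalEquality using (_≡_)
open import Relation.Nullary using (¬_)
open import Algebra.Structures using (IsCommutativeRing)

IsPrimePower : ℕ → Set
IsPrimePower q = Σ ℕ λ p → Σ ℕ λ e → Prime p × 1 ≤ e × q ≡ p ^ e

record FiniteField : Set₁ where
  field
    K      : Set
    _+_    : K → K → K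
    _*_    : K → K → K
    -_     : K → K
    0#     : K
    1#     : K
    isCommutativeRing : IsCommutativeRing _≡_ _+_ _*_ -_ 0# 1#
    0≢1    : ¬ (0# ≡ 1#)
    _⁻¹    : K → K
    inverse : ∀ x → ¬ (x ≡ 0#) → x * (x ⁻¹) ≡ 1#
    elems  : List K
    complete : ∀ x → x ∈ elems
    unique : Unique elems

  card : ℕ
  card = length elems

  pow : K → ℕ → K
  pow x zero    = 1#
  pow x (suc m) = x * pow x m

module OverField (𝔽 : FiniteField) (q : ℕ) where
  open FiniteField 𝔽

  -- the subfield F_q of F_{q^n}: the elements fixed by x ↦ x^q
  InFq : K → Set
  InFq x = pow x q ≡ x

  -- Generic F_q-linear notions on an F_{q^n}-module V, using only
  -- scalars from F_q.
  module Lin {V : Set} (0V : V) (_⊕_ : V → V → V) (_•_ : K → V → V) where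

    Subspace : (V → Set) → Set
    Subspace A = A 0V × (∀ x y → A x → A y → A (x ⊕ y))
                      × (∀ c x → InFq c → A x → A (c • x))

    lincomb : ∀ {d} → Vec K d → Vec V d → V
    lincomb []       []       = 0V
    lincomb (c ∷ cs) (v ∷ vs) = (c • v) ⊕ lincomb cs vs

    LinIndep : ∀ {d} → Vec V d → Set
    LinIndep {d} vs = (cs : Vec K d) → All InFq cs → lincomb cs vs ≡ 0V → All (_≡ 0#) cs

    Spans : ∀ {d} → (V → Set) → Vec V d → Set
    Spans {d} A vs = ∀ x → A x → Σ (Vec K d) λ cs → All InFq cs × lincomb cs vs ≡ x

    HasDim : (V → Set) → ℕ → Set
    HasDim A d = Σ (Vec V d) λ vs → All A vs × LinIndep vs × Spans A vs

  module LinK = Lin 0# _+_ _*_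

  Pt : Set
  Pt = K × K

  0P : Pt
  0P = 0# , 0#

  _⊕P_ : Pt → Pt → Pt
  (a , b) ⊕P (c , d) = (a + c) , (b + d)

  _•P_ : K → Pt → Pt
  λ' •P (a , b) = (λ' * a) , (λ' * b)

  module LinP = Lin 0P _⊕P_ _•P_

  _⊠_ : (K → Set) → (K → Set) → Pt → Set
  (S ⊠ T) (s , t) = S s × T t

  Span : Pt → Pt → Set
  Span v w = Σ K λ λ' → w ≡ λ' •P v

  -- v, w nonzero define the same point of PG(1,q^n)
  SamePoint : Pt → Pt → Set
  SamePoint v w = Σ K λ λ' → w ≡ λ' •P v

  Weight≥2 : (Pt → Set) → Pt → Set
  Weight≥2 U v = Σ ℕ λ d → 2 ≤ d × LinP.HasDim (λ w → U w × Span v w) d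

  -- L_U has at most two points of weight ≥ 2 (only two points of
  -- weight at least two): among any three such points two coincide.
  AtMostTwoHeavyPoints : (Pt → Set) → Set
  AtMostTwoHeavyPoints U =
    ∀ v₁ v₂ v₃ → ¬ (v₁ ≡ 0P) → ¬ (v₂ ≡ 0P) → ¬ (v₃ ≡ 0P)
    → Weight≥2 U v₁ → Weight≥2 U v₂ → Weight≥2 U v₃
    → SamePoint v₁ v₂ ⊎ (SamePoint v₁ v₃ ⊎ SamePoint v₂ v₃)

  scaleSet : K → (K → Set) → K → Set
  scaleSet a S x = Σ K λ s → S s × x ≡ a * s

  _∩_ : (K → Set) → (K → Set) → K → Set
  (A ∩ B) x = A x × B x

-- Suppose every a₁S ∩ a₂S with a₁, a₂ ∈ T independent is trivial. A point ⟨(a, b)⟩ of weight ≥ 2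
-- with a, b ≠ 0 contains independent l₁(a, b), l₂(a, b) ∈ S × T, and then (l₁ b)(l₂ a) = (l₂ b)(l₁ a)
-- is a nonzero element of (l₁ b)S ∩ (l₂ b)S. So the heavy points lie on the two axes, each of which
-- is a single point of PG(1, q^n). Conversely, if x = a₁ s₁ = a₂ s₂ ≠ 0, the three points ⟨(1, 0)⟩,
-- ⟨(0, 1)⟩ and ⟨(x, a₁ a₂)⟩ contain the independent pairs (s₂, 0), (s₁, 0); (0, a₁), (0, a₂); and
-- (s₂, a₁) = a₂⁻¹(x, a₁ a₂), (s₁, a₂) = a₁⁻¹(x, a₁ a₂).
--
-- Weight ≥ 2 asks for a whole basis of U ∩ ⟨v⟩; it is obtained by greedily extending an independent
-- pair along an enumeration of K². That needs 𝔽_q = {x | x^q = x} to be closed under negation,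
-- i.e. (-1)^q = -1, which for even q holds because a field of even order has characteristic 2.

module Submission where

open import Defs
open import Level using (0ℓ)
open import Algebra.Bundles using (CommutativeRing)
open import Data.Empty using (⊥; ⊥-elim)
open import Data.List using (List; []; _∷_; length; filter; cartesianProduct)
open import Data.List.Membership.Propositional using (_∈_)
open import Data.List.Membership.Propositional.Properties using (∈-filter⁺; ∈-filter⁻; ∈-cartesianProduct⁺)
open import Data.List.Properties using (filter-accept; filter-reject; filter-all)
import Data.List.Relation.Unary.All as ListAll
open import Data.List.Relation.Unary.Any as Any using (here; there)
open import Data.List.Relation.Unary.AllPairs using (_∷_)
open import Data.List.Relation.Unary.Unique.Propositional using (Unique)
import Data.List.Relation.Unary.Unique.Propositional.Properties as Unique
open import Data.Nat using (ℕ; zero; suc; _≤_; s≤s; _∸_; _^_; parity; NonZero)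
import Data.Nat.Properties as ℕ
open import Data.Parity.Base as ℙ using (0ℙ; 1ℙ)
import Data.Parity.Properties as ℙ
open import Data.Product using (Σ; ∃; _×_; _,_; proj₁; proj₂)
open import Data.Product.Properties using (≡-dec)
open import Data.Sum using (_⊎_; inj₁; inj₂)
open import Data.Vec using (Vec; []; _∷_; _++_; map; replicate)
import Data.Vec.Properties as Vec
open import Data.Vec.Relation.Unary.All as All using (All; []; _∷_)
import Data.Vec.Relation.Unary.All.Properties as All
open import Relation.Binary.Definitions using (DecidableEquality)
open import Relation.Binary.PropositionalEquality
open import Relation.Nullary using (¬_; Dec; yes; no; ¬?; _×-dec_)
open import Relation.Nullary.Decidable using (map′; decidable-stable)
open import Relation.Unary using (Decidable)
open import Function using (_∘_)
open import Function.Bundles using (_⇔_; mk⇔)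

Searchable : Set → Set₁
Searchable A = ∀ {P : A → Set} → Decidable P → Dec (∃ P)

module _ {A : Set} where

  searchable-enumerated : {xs : List A} → (∀ x → x ∈ xs) → Searchable A
  searchable-enumerated {xs} complete P? =
    map′ Any.satisfied (λ (x , px) → Any.map (λ { refl → px }) (complete x)) (Any.any? P? xs)

  searchable-Vec : Searchable A → ∀ d → Searchable (Vec A d)
  searchable-Vec search zero    P? = map′ ([] ,_) (λ { ([] , p) → p }) (P? [])
  searchable-Vec search (suc d) P? =
    map′ (λ (x , xs , p) → x ∷ xs , p) (λ { (x ∷ xs , p) → x , xs , p })
         (search (λ x → searchable-Vec search d (λ xs → P? (x ∷ xs))))

  ≟-unique : {xs : List A} → Unique xs → ∀ {x y} → x ∈ xs → y ∈ xs → Dec (x ≡ y)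
  ≟-unique _          (here refl) (here refl) = yes refl
  ≟-unique (x≢ ∷ _)   (here refl) (there y∈)  = no λ { refl → ListAll.lookup x≢ y∈ refl }
  ≟-unique (y≢ ∷ _)   (there x∈)  (here refl) = no λ { refl → ListAll.lookup y≢ x∈ refl }
  ≟-unique (_ ∷ uniq) (there x∈)  (there y∈)  = ≟-unique uniq x∈ y∈

  module _ (_≟_ : DecidableEquality A) where

    without : A → List A → List A
    without y = filter (λ z → ¬? (z ≟ y))

    ∈-without⁻ : ∀ {xs y z} → z ∈ without y xs → z ∈ xs × z ≢ y
    ∈-without⁻ {xs} {y} = ∈-filter⁻ (λ z → ¬? (z ≟ y)) {xs = xs}

    ∈-without⁺ : ∀ {xs y z} → z ∈ xs → z ≢ y → z ∈ without y xs
    ∈-without⁺ {y = y} = ∈-filter⁺ (λ z → ¬? (z ≟ y))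

    without-unique : ∀ {xs} y → Unique xs → Unique (without y xs)
    without-unique y = Unique.filter⁺ (λ z → ¬? (z ≟ y))

    length-without : ∀ {xs y} → Unique xs → y ∈ xs → length xs ≡ suc (length (without y xs))
    length-without {x ∷ xs} (x≢ ∷ _) (here refl)
      rewrite filter-reject (λ z → ¬? (z ≟ x)) {x} {xs} (λ x≢x → x≢x refl)
            | filter-all (λ z → ¬? (z ≟ x)) {xs} (ListAll.map (λ x≢z z≡x → x≢z (sym z≡x)) x≢) = refl
    length-without {x ∷ xs} {y} (x≢ ∷ uniq) (there y∈)
      rewrite filter-accept (λ z → ¬? (z ≟ y)) {x} {xs} (λ { refl → ListAll.lookup x≢ y∈ refl }) =
      cong suc (length-without uniq y∈)

    module _ (f : A → A) (f-involutive : ∀ x → f (f x) ≡ x) where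

      fixedPointFree-even : ∀ n {xs} → length xs ≡ n → Unique xs
        → (∀ {x} → x ∈ xs → f x ∈ xs) → (∀ {x} → x ∈ xs → f x ≢ x) → parity n ≡ 0ℙ
      fixedPointFree-even zero _ _ _ _ = refl
      fixedPointFree-even (suc zero) {x ∷ []} _ _ closed fixedPointFree with closed (here refl)
      ... | here fx≡x = ⊥-elim (fixedPointFree (here refl) fx≡x)
      fixedPointFree-even (suc (suc n)) {x ∷ xs} len (x≢ ∷ uniq) closed fixedPointFree =
        fixedPointFree-even n len′ (without-unique (f x) uniq) closed′
          (λ z∈ → fixedPointFree (there (proj₁ (∈-without⁻ z∈))))
        where
        fx∈xs : f x ∈ xs
        fx∈xs with closed (here refl)
        ... | here fx≡x = ⊥-elim (fixedPointFree (here refl) fx≡x)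
        ... | there fx∈ = fx∈

        len′ : length (without (f x) xs) ≡ n
        len′ = ℕ.suc-injective (trans (sym (length-without uniq fx∈xs)) (ℕ.suc-injective len))

        closed′ : ∀ {z} → z ∈ without (f x) xs → f z ∈ without (f x) xs
        closed′ {z} z∈ with ∈-without⁻ z∈
        ... | z∈xs , z≢fx with closed (there z∈xs)
        ... | here fz≡x = ⊥-elim (z≢fx (trans (sym (f-involutive z)) (cong f fz≡x)))
        ... | there fz∈ = ∈-without⁺ fz∈ λ fz≡fx →
          ListAll.lookup x≢ z∈xs (sym (trans (sym (f-involutive z)) (trans (cong f fz≡fx) (f-involutive x))))

module FieldLemmas (𝔽 : FiniteField) where
  open FiniteField 𝔽 renaming (_+_ to infixl 6 _+_; _*_ to infixl 7 _*_; -_ to infix 8 -_; _⁻¹ to infix 9 _⁻¹)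

  commutativeRing : CommutativeRing 0ℓ 0ℓ
  commutativeRing = record { isCommutativeRing = isCommutativeRing }

  open CommutativeRing commutativeRing public
    using (+-identityʳ; +-identityˡ; *-identityˡ; *-identityʳ; *-assoc; *-comm; zeroˡ; zeroʳ; distribʳ; -‿inverseʳ; +-group)
  open import Algebra.Properties.Ring (CommutativeRing.ring commutativeRing) public
    using (-1*x≈-x; -‿distribˡ-*; -‿distribʳ-*)
  open import Algebra.Properties.Group +-group public
    using (inverseˡ-unique; inverseʳ-unique; ⁻¹-involutive; ε⁻¹≈ε)
  open import Algebra.Solver.Ring.NaturalCoefficients.Default (CommutativeRing.commutativeSemiring commutativeRing) public
  open ≡-Reasoning

  _≟_ : DecidableEquality K
  x ≟ y = ≟-unique unique (complete x) (complete y)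

  searchable : Searchable K
  searchable = searchable-enumerated complete

  x⁻¹*x≡1 : ∀ {x} → x ≢ 0# → x ⁻¹ * x ≡ 1#
  x⁻¹*x≡1 {x} x≢0 = trans (*-comm _ x) (inverse x x≢0)

  x⁻¹*[x*y]≡y : ∀ {x} y → x ≢ 0# → x ⁻¹ * (x * y) ≡ y
  x⁻¹*[x*y]≡y {x} y x≢0 = begin
    x ⁻¹ * (x * y) ≡⟨ sym (*-assoc _ x y) ⟩
    x ⁻¹ * x * y   ≡⟨ cong (_* y) (x⁻¹*x≡1 x≢0) ⟩
    1# * y         ≡⟨ *-identityˡ y ⟩
    y              ∎

  y≡x*z⇒z≡x⁻¹*y : ∀ {x y z} → x ≢ 0# → y ≡ x * z → z ≡ x ⁻¹ * y
  y≡x*z⇒z≡x⁻¹*y {x} {z = z} x≢0 y≡xz = trans (sym (x⁻¹*[x*y]≡y z x≢0)) (cong (x ⁻¹ *_) (sym y≡xz))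

  x*y⁻¹*y≡x : ∀ x {y} → y ≢ 0# → x * y ⁻¹ * y ≡ x
  x*y⁻¹*y≡x x {y} y≢0 = trans (*-assoc x _ y) (trans (cong (x *_) (x⁻¹*x≡1 y≢0)) (*-identityʳ x))

  x*y≡0⇒y≡0 : ∀ {x y} → x ≢ 0# → x * y ≡ 0# → y ≡ 0#
  x*y≡0⇒y≡0 {x} {y} x≢0 xy≡0 = begin
    y              ≡⟨ sym (x⁻¹*[x*y]≡y y x≢0) ⟩
    x ⁻¹ * (x * y) ≡⟨ cong (x ⁻¹ *_) xy≡0 ⟩
    x ⁻¹ * 0#      ≡⟨ zeroʳ _ ⟩
    0#             ∎

  x*y≢0 : ∀ {x y} → x ≢ 0# → y ≢ 0# → x * y ≢ 0#
  x*y≢0 x≢0 y≢0 xy≡0 = y≢0 (x*y≡0⇒y≡0 x≢0 xy≡0)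

  1≢0 : 1# ≢ 0#
  1≢0 1≡0 = 0≢1 (sym 1≡0)

  c*x+y≡0⇒x≡-c⁻¹*y : ∀ {c x y} → c ≢ 0# → c * x + y ≡ 0# → x ≡ - c ⁻¹ * y
  c*x+y≡0⇒x≡-c⁻¹*y {c} {x} {y} c≢0 eq = begin
    x              ≡⟨ sym (x⁻¹*[x*y]≡y x c≢0) ⟩
    c ⁻¹ * (c * x) ≡⟨ cong (c ⁻¹ *_) (inverseˡ-unique (c * x) y eq) ⟩
    c ⁻¹ * - y     ≡⟨ sym (-‿distribʳ-* (c ⁻¹) y) ⟩
    - (c ⁻¹ * y)   ≡⟨ -‿distribˡ-* (c ⁻¹) y ⟩
    - c ⁻¹ * y     ∎

  pow-distrib-* : ∀ x y m → pow (x * y) m ≡ pow x m * pow y m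
  pow-distrib-* x y zero    = sym (*-identityˡ 1#)
  pow-distrib-* x y (suc m) = begin
    x * y * pow (x * y) m        ≡⟨ cong (x * y *_) (pow-distrib-* x y m) ⟩
    x * y * (pow x m * pow y m)  ≡⟨ solve 4 (λ x y a b → x :* y :* (a :* b) := x :* a :* (y :* b)) refl x y (pow x m) (pow y m) ⟩
    x * pow x m * (y * pow y m)  ∎

  pow-1# : ∀ m → pow 1# m ≡ 1#
  pow-1# zero    = refl
  pow-1# (suc m) = trans (*-identityˡ _) (pow-1# m)

  pow-0# : ∀ m .{{_ : NonZero m}} → pow 0# m ≡ 0#
  pow-0# (suc m) = zeroˡ _

  pow-[-1]-2+ : ∀ m → pow (- 1#) (suc (suc m)) ≡ pow (- 1#) m
  pow-[-1]-2+ m = begin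
    - 1# * (- 1# * pow (- 1#) m) ≡⟨ sym (*-assoc _ _ _) ⟩
    - 1# * - 1# * pow (- 1#) m   ≡⟨ cong (_* pow (- 1#) m) (trans (-1*x≈-x (- 1#)) (⁻¹-involutive 1#)) ⟩
    1# * pow (- 1#) m            ≡⟨ *-identityˡ _ ⟩
    pow (- 1#) m                 ∎

  pow-[-1]-even : ∀ m → parity m ≡ 0ℙ → pow (- 1#) m ≡ 1#
  pow-[-1]-even zero          _    = refl
  pow-[-1]-even (suc (suc m)) even = trans (pow-[-1]-2+ m) (pow-[-1]-even m even)

  pow-[-1]-odd : ∀ m → parity m ≡ 1ℙ → pow (- 1#) m ≡ - 1#
  pow-[-1]-odd (suc zero)    _   = *-identityʳ _
  pow-[-1]-odd (suc (suc m)) odd = trans (pow-[-1]-2+ m) (pow-[-1]-odd m odd)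

  -x≡0⇒x≡0 : ∀ {x} → - x ≡ 0# → x ≡ 0#
  -x≡0⇒x≡0 {x} -x≡0 = trans (sym (⁻¹-involutive x)) (trans (cong -_ -x≡0) ε⁻¹≈ε)

  -x≡x⇒x≡0 : 1# + 1# ≢ 0# → ∀ {x} → - x ≡ x → x ≡ 0#
  -x≡x⇒x≡0 2≢0 {x} -x≡x = x*y≡0⇒y≡0 2≢0 (begin
    (1# + 1#) * x     ≡⟨ distribʳ x 1# 1# ⟩
    1# * x + 1# * x   ≡⟨ cong₂ _+_ (*-identityˡ x) (*-identityˡ x) ⟩
    x + x             ≡⟨ cong (x +_) (sym -x≡x) ⟩
    x + - x           ≡⟨ -‿inverseʳ x ⟩
    0#                ∎)

  -- Outside characteristic 2, negation pairs off the nonzero elements.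
  card-odd : 1# + 1# ≢ 0# → parity card ≡ 1ℙ
  card-odd 2≢0 = begin
    parity card                       ≡⟨ cong parity (length-without _≟_ unique (complete 0#)) ⟩
    parity (suc (length nonzero))     ≡⟨ sym (ℙ.⁻¹-selfInverse (trans (ℙ.suc-homo-⁻¹ (length nonzero)) nonzero-even)) ⟩
    1ℙ                                ∎
    where
    nonzero : List K
    nonzero = without _≟_ 0# elems

    nonzero⁻ : ∀ {x} → x ∈ nonzero → x ≢ 0#
    nonzero⁻ x∈ = proj₂ (∈-without⁻ _≟_ {elems} x∈)

    nonzero-even : parity (length nonzero) ≡ 0ℙ
    nonzero-even = fixedPointFree-even _≟_ -_ ⁻¹-involutive _ refl (without-unique _≟_ 0# unique)
      (λ {x} x∈ → ∈-without⁺ _≟_ (complete (- x)) (λ -x≡0 → nonzero⁻ x∈ (-x≡0⇒x≡0 -x≡0)))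
      (λ x∈ -x≡x → nonzero⁻ x∈ (-x≡x⇒x≡0 2≢0 -x≡x))

  pow-[-1]≡-1 : ∀ {q n} → card ≡ q ^ suc n → pow (- 1#) q ≡ - 1#
  pow-[-1]≡-1 {q} {n} card≡q^[1+n] with parity q in parity-q
  ... | 1ℙ = pow-[-1]-odd q parity-q
  ... | 0ℙ with (1# + 1#) ≟ 0#
  ...   | yes 2≡0 = trans (pow-[-1]-even q parity-q) (inverseʳ-unique 1# 1# 2≡0)
  ...   | no 2≢0 = ⊥-elim (ℙ.p≢p⁻¹ 0ℙ (begin
    0ℙ                                ≡⟨ cong (ℙ._* parity (q ^ n)) (sym parity-q) ⟩
    parity q ℙ.* parity (q ^ n)       ≡⟨ sym (ℙ.*-homo-* q (q ^ n)) ⟩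
    parity (q ^ suc n)                ≡⟨ cong parity (sym card≡q^[1+n]) ⟩
    parity card                       ≡⟨ card-odd 2≢0 ⟩
    1ℙ                                ∎))

  card≢0 : card ≢ 0
  card≢0 = nonempty (complete 0#)
    where
    nonempty : ∀ {x : K} {xs} → x ∈ xs → length xs ≢ 0
    nonempty (here _)  ()
    nonempty (there _) ()

module Subfield (𝔽 : FiniteField) (q : ℕ) .{{_ : NonZero q}} where
  open FiniteField 𝔽 renaming (_+_ to infixl 6 _+_; _*_ to infixl 7 _*_; -_ to infix 8 -_; _⁻¹ to infix 9 _⁻¹)
  open FieldLemmas 𝔽
  open OverField 𝔽 q
  open ≡-Reasoning

  module _ (-1∈Fq : InFq (- 1#)) where

    InFq-0# : InFq 0#
    InFq-0# = pow-0# q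

    InFq-1# : InFq 1#
    InFq-1# = pow-1# q

    InFq-* : ∀ {x y} → InFq x → InFq y → InFq (x * y)
    InFq-* {x} {y} x∈ y∈ = trans (pow-distrib-* x y q) (cong₂ _*_ x∈ y∈)

    InFq-neg : ∀ {x} → InFq x → InFq (- x)
    InFq-neg {x} x∈ = subst InFq (-1*x≈-x x) (InFq-* -1∈Fq x∈)

    InFq-⁻¹ : ∀ {x} → x ≢ 0# → InFq x → InFq (x ⁻¹)
    InFq-⁻¹ {x} x≢0 x∈ = begin
      pow (x ⁻¹) q                    ≡⟨ sym (x⁻¹*[x*y]≡y _ x≢0) ⟩
      x ⁻¹ * (x * pow (x ⁻¹) q)       ≡⟨ cong (λ y → x ⁻¹ * (y * pow (x ⁻¹) q)) (sym x∈) ⟩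
      x ⁻¹ * (pow x q * pow (x ⁻¹) q) ≡⟨ cong (x ⁻¹ *_) (sym (pow-distrib-* x (x ⁻¹) q)) ⟩
      x ⁻¹ * pow (x * x ⁻¹) q         ≡⟨ cong (λ y → x ⁻¹ * pow y q) (inverse x x≢0) ⟩
      x ⁻¹ * pow 1# q                 ≡⟨ cong (x ⁻¹ *_) (pow-1# q) ⟩
      x ⁻¹ * 1#                       ≡⟨ *-identityʳ _ ⟩
      x ⁻¹                            ∎

    InFq? : Decidable InFq
    InFq? x = pow x q ≟ x

    All-InFq-replicate : ∀ d → All InFq (replicate d 0#)
    All-InFq-replicate zero    = []
    All-InFq-replicate (suc d) = InFq-0# ∷ All-InFq-replicate d

    All-InFq-map-* : ∀ {d m} {cs : Vec K d} → InFq m → All InFq cs → All InFq (map (m *_) cs)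
    All-InFq-map-* m∈ cs∈ = All.map⁺ (All.map (InFq-* m∈) cs∈)

    lincomb-replicate-0# : ∀ {d} (xs : Vec K d) → LinK.lincomb (replicate d 0#) xs ≡ 0#
    lincomb-replicate-0# []       = refl
    lincomb-replicate-0# (x ∷ xs) = begin
      0# * x + LinK.lincomb (replicate _ 0#) xs ≡⟨ cong₂ _+_ (zeroˡ x) (lincomb-replicate-0# xs) ⟩
      0# + 0#                                   ≡⟨ +-identityʳ 0# ⟩
      0#                                        ∎

    lincomb-map-*ˡ : ∀ {d} m (cs : Vec K d) xs → LinK.lincomb (map (m *_) cs) xs ≡ m * LinK.lincomb cs xs
    lincomb-map-*ˡ m []       []       = sym (zeroʳ m)
    lincomb-map-*ˡ m (c ∷ cs) (x ∷ xs) = begin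
      m * c * x + LinK.lincomb (map (m *_) cs) xs ≡⟨ cong (m * c * x +_) (lincomb-map-*ˡ m cs xs) ⟩
      m * c * x + m * LinK.lincomb cs xs
        ≡⟨ solve 4 (λ m c x l → m :* c :* x :+ m :* l := m :* (c :* x :+ l)) refl m c x _ ⟩
      m * (c * x + LinK.lincomb cs xs)            ∎

    lincomb-map-*ʳ : ∀ {d} m (cs : Vec K d) xs → LinK.lincomb cs (map (_* m) xs) ≡ LinK.lincomb cs xs * m
    lincomb-map-*ʳ m []       []       = sym (zeroˡ m)
    lincomb-map-*ʳ m (c ∷ cs) (x ∷ xs) = begin
      c * (x * m) + LinK.lincomb cs (map (_* m) xs) ≡⟨ cong (c * (x * m) +_) (lincomb-map-*ʳ m cs xs) ⟩
      c * (x * m) + LinK.lincomb cs xs * m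
        ≡⟨ solve 4 (λ m c x l → c :* (x :* m) :+ l :* m := (c :* x :+ l) :* m) refl m c x _ ⟩
      (c * x + LinK.lincomb cs xs) * m              ∎

    Subspace-lincomb : ∀ {A d} → LinK.Subspace A → {xs : Vec K d} → All A xs → ∀ {cs} → All InFq cs → A (LinK.lincomb cs xs)
    Subspace-lincomb (0∈A , _ , _)          []          []          = 0∈A
    Subspace-lincomb A-subspace@(_ , +-closed , •-closed) (x∈ ∷ xs∈) (c∈ ∷ cs∈) =
      +-closed _ _ (•-closed _ _ c∈ x∈) (Subspace-lincomb A-subspace xs∈ cs∈)

    HasDim⇒Decidable : ∀ {A d} → LinK.Subspace A → LinK.HasDim A d → Decidable A
    HasDim⇒Decidable {A} {d} A-subspace (xs , xs∈ , _ , spans) x =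
      map′ (λ (cs , cs∈ , lincomb≡x) → subst A lincomb≡x (Subspace-lincomb A-subspace xs∈ cs∈)) (spans x)
           (searchable-Vec searchable d (λ cs → All.all? InFq? cs ×-dec LinK.lincomb cs xs ≟ x))

    LinIndep-map-* : ∀ {d m} {xs : Vec K d} → m ≢ 0# → LinK.LinIndep xs → LinK.LinIndep (map (_* m) xs)
    LinIndep-map-* {m = m} {xs} m≢0 indep cs cs∈ lincomb≡0 =
      indep cs cs∈ (x*y≡0⇒y≡0 m≢0 (trans (*-comm m _) (trans (sym (lincomb-map-*ʳ m cs xs)) lincomb≡0)))

    LinIndep-map-*⁻ : ∀ {d m} {xs : Vec K d} → LinK.LinIndep (map (_* m) xs) → LinK.LinIndep xs
    LinIndep-map-*⁻ {m = m} {xs} indep cs cs∈ lincomb≡0 =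
      indep cs cs∈ (trans (lincomb-map-*ʳ m cs xs) (trans (cong (_* m) lincomb≡0) (zeroˡ m)))

    LinIndep₂⇒≢0 : ∀ {x y} → LinK.LinIndep (x ∷ y ∷ []) → x ≢ 0# × y ≢ 0#
    LinIndep₂⇒≢0 {x} {y} indep = x≢0 , y≢0
      where
      x≢0 : x ≢ 0#
      x≢0 x≡0 with indep (1# ∷ 0# ∷ []) (InFq-1# ∷ InFq-0# ∷ [])
                         (trans (solve 2 (λ x y → con 1 :* x :+ (con 0 :* y :+ con 0) := x) refl x y) x≡0)
      ... | 1≡0 ∷ _ = 1≢0 1≡0
      y≢0 : y ≢ 0#
      y≢0 y≡0 with indep (0# ∷ 1# ∷ []) (InFq-0# ∷ InFq-1# ∷ [])
                         (trans (solve 2 (λ x y → con 0 :* x :+ (con 1 :* y :+ con 0) := y) refl x y) y≡0)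
      ... | _ ∷ 1≡0 ∷ _ = 1≢0 1≡0

    -- multiplication by a₁ a₂ carries (s₂, s₁) to x (a₁, a₂), where x = a₁ s₁ = a₂ s₂
    commonMultiple⇒LinIndep : ∀ {a₁ a₂ s₁ s₂} → LinK.LinIndep (a₁ ∷ a₂ ∷ [])
      → a₁ * s₁ ≡ a₂ * s₂ → a₁ * s₁ ≢ 0# → LinK.LinIndep (s₂ ∷ s₁ ∷ [])
    commonMultiple⇒LinIndep {a₁} {a₂} {s₁} {s₂} indep a₁s₁≡a₂s₂ x≢0 =
      LinIndep-map-*⁻ (subst LinK.LinIndep (cong₂ _∷_ first (cong₂ _∷_ second refl)) (LinIndep-map-* x≢0 indep))
      where
      first : a₁ * (a₁ * s₁) ≡ s₂ * (a₁ * a₂)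
      first = trans (cong (a₁ *_) a₁s₁≡a₂s₂)
                    (solve 3 (λ a₁ a₂ s → a₁ :* (a₂ :* s) := s :* (a₁ :* a₂)) refl a₁ a₂ s₂)

      second : a₂ * (a₁ * s₁) ≡ s₁ * (a₁ * a₂)
      second = solve 3 (λ a₁ a₂ s → a₂ :* (a₁ :* s) := s :* (a₁ :* a₂)) refl a₁ a₂ s₁

    HasDim0⇒≡0 : ∀ {A x} → LinK.HasDim A 0 → A x → x ≡ 0#
    HasDim0⇒≡0 ([] , _ , _ , spans) x∈ with spans _ x∈
    ... | [] , _ , 0≡x = sym 0≡x

    ≡0⇒HasDim0 : ∀ {A} → (∀ {x} → A x → x ≡ 0#) → LinK.HasDim A 0
    ≡0⇒HasDim0 A⊆0 = [] , [] , (λ { [] _ _ → [] }) , λ x x∈ → [] , [] , sym (A⊆0 x∈)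

    lincombP≡ : ∀ {d} (cs : Vec K d) ws → LinP.lincomb cs ws ≡ (LinK.lincomb cs (map proj₁ ws) , LinK.lincomb cs (map proj₂ ws))
    lincombP≡ []       []             = refl
    lincombP≡ (c ∷ cs) ((a , b) ∷ ws) rewrite lincombP≡ cs ws = refl

    LinIndep-proj₁ : ∀ {d} {ws : Vec Pt d} → LinK.LinIndep (map proj₁ ws) → LinP.LinIndep ws
    LinIndep-proj₁ {ws = ws} indep cs cs∈ lincomb≡0 = indep cs cs∈ (cong proj₁ (trans (sym (lincombP≡ cs ws)) lincomb≡0))

    LinIndep-proj₂ : ∀ {d} {ws : Vec Pt d} → LinK.LinIndep (map proj₂ ws) → LinP.LinIndep ws
    LinIndep-proj₂ {ws = ws} indep cs cs∈ lincomb≡0 = indep cs cs∈ (cong proj₂ (trans (sym (lincombP≡ cs ws)) lincomb≡0))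

    LinIndep-map-•P⁻ : ∀ {d} {xs : Vec K d} v → LinP.LinIndep (map (_•P v) xs) → LinK.LinIndep xs
    LinIndep-map-•P⁻ {xs = xs} v@(a , b) indep cs cs∈ lincomb≡0 = indep cs cs∈ (begin
      LinP.lincomb cs (map (_•P v) xs)
        ≡⟨ lincombP≡ cs _ ⟩
      LinK.lincomb cs (map proj₁ (map (_•P v) xs)) , LinK.lincomb cs (map proj₂ (map (_•P v) xs))
        ≡⟨ cong₂ (λ ys zs → LinK.lincomb cs ys , LinK.lincomb cs zs)
                 (sym (Vec.map-∘ proj₁ (_•P v) xs)) (sym (Vec.map-∘ proj₂ (_•P v) xs)) ⟩
      LinK.lincomb cs (map (_* a) xs) , LinK.lincomb cs (map (_* b) xs)
        ≡⟨ cong₂ _,_ (lincomb-map-*ʳ a cs xs) (lincomb-map-*ʳ b cs xs) ⟩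
      LinK.lincomb cs xs * a , LinK.lincomb cs xs * b
        ≡⟨ cong (λ l → l * a , l * b) lincomb≡0 ⟩
      0# * a , 0# * b
        ≡⟨ cong₂ _,_ (zeroˡ a) (zeroˡ b) ⟩
      0P ∎)

    lincombP-replicate-0# : ∀ {d} (ws : Vec Pt d) → LinP.lincomb (replicate d 0#) ws ≡ 0P
    lincombP-replicate-0# {d} ws =
      trans (lincombP≡ (replicate d 0#) ws) (cong₂ _,_ (lincomb-replicate-0# (map proj₁ ws)) (lincomb-replicate-0# (map proj₂ ws)))

    lincombP-map-* : ∀ {d} m (cs : Vec K d) ws → LinP.lincomb (map (m *_) cs) ws ≡ m •P LinP.lincomb cs ws
    lincombP-map-* m cs ws rewrite lincombP≡ (map (m *_) cs) ws | lincombP≡ cs ws =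
      cong₂ _,_ (lincomb-map-*ˡ m cs _) (lincomb-map-*ˡ m cs _)

    LinIndep-++⁻ˡ : ∀ {d e} (ws : Vec Pt d) {us : Vec Pt e} → LinP.LinIndep (ws ++ us) → LinP.LinIndep ws
    LinIndep-++⁻ˡ {e = e} ws {us} indep cs cs∈ lincomb≡0 =
      All.++ˡ⁻ cs (indep (cs ++ replicate e 0#) (All.++⁺ cs∈ (All-InFq-replicate e)) (trans (padded cs ws) lincomb≡0))
      where
      padded : ∀ {d} (cs : Vec K d) ws → LinP.lincomb (cs ++ replicate e 0#) (ws ++ us) ≡ LinP.lincomb cs ws
      padded []       []       = lincombP-replicate-0# us
      padded (c ∷ cs) (w ∷ ws) = cong ((c •P w) ⊕P_) (padded cs ws)

    _≟P_ : DecidableEquality Pt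
    _≟P_ = ≡-dec _≟_ _≟_

    allPts : List Pt
    allPts = cartesianProduct elems elems

    allPts-complete : ∀ w → w ∈ allPts
    allPts-complete (a , b) = ∈-cartesianProduct⁺ (complete a) (complete b)

    InSpan : ∀ {d} → Vec Pt d → Pt → Set
    InSpan {d} ws w = Σ (Vec K d) λ cs → All InFq cs × LinP.lincomb cs ws ≡ w

    InSpan? : ∀ {d} (ws : Vec Pt d) → Decidable (InSpan ws)
    InSpan? {d} ws w = searchable-Vec searchable d (λ cs → All.all? InFq? cs ×-dec LinP.lincomb cs ws ≟P w)

    0•P⊕P : ∀ w u → (0# •P w) ⊕P u ≡ u
    0•P⊕P (a , b) (c , d) =
      cong₂ _,_ (trans (cong (_+ c) (zeroˡ a)) (+-identityˡ c)) (trans (cong (_+ d) (zeroˡ b)) (+-identityˡ d))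

    c•Pw⊕Pu≡0⇒w≡-c⁻¹•Pu : ∀ {c} w u → c ≢ 0# → (c •P w) ⊕P u ≡ 0P → w ≡ (- c ⁻¹) •P u
    c•Pw⊕Pu≡0⇒w≡-c⁻¹•Pu (a , b) (c , d) c≢0 eq =
      cong₂ _,_ (c*x+y≡0⇒x≡-c⁻¹*y c≢0 (cong proj₁ eq)) (c*x+y≡0⇒x≡-c⁻¹*y c≢0 (cong proj₂ eq))

    InSpan-head : ∀ {d} w (ws : Vec Pt d) → InSpan (w ∷ ws) w
    InSpan-head {d} w@(a , b) ws = 1# ∷ replicate d 0# , InFq-1# ∷ All-InFq-replicate d , (begin
      (1# •P w) ⊕P LinP.lincomb (replicate d 0#) ws ≡⟨ cong ((1# •P w) ⊕P_) (lincombP-replicate-0# ws) ⟩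
      (1# * a + 0# , 1# * b + 0#)
        ≡⟨ cong₂ _,_ (trans (+-identityʳ _) (*-identityˡ a)) (trans (+-identityʳ _) (*-identityˡ b)) ⟩
      w                                              ∎)

    InSpan-∷ : ∀ {d} w {ws : Vec Pt d} {u} → InSpan ws u → InSpan (w ∷ ws) u
    InSpan-∷ w (cs , cs∈ , lincomb≡u) = 0# ∷ cs , InFq-0# ∷ cs∈ , trans (0•P⊕P w _) lincomb≡u

    LinIndep-∷ : ∀ {d} {ws : Vec Pt d} {w} → LinP.LinIndep ws → ¬ InSpan ws w → LinP.LinIndep (w ∷ ws)
    LinIndep-∷ {ws = ws} {w} indep w∉ (c ∷ cs) (c∈ ∷ cs∈) lincomb≡0 with c ≟ 0#
    ... | yes refl = refl ∷ indep cs cs∈ (trans (sym (0•P⊕P w _)) lincomb≡0)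
    ... | no c≢0   = ⊥-elim (w∉ (map (- c ⁻¹ *_) cs , All-InFq-map-* (InFq-neg (InFq-⁻¹ c≢0 c∈)) cs∈ ,
                       trans (lincombP-map-* _ cs ws) (sym (c•Pw⊕Pu≡0⇒w≡-c⁻¹•Pu w _ c≢0 lincomb≡0))))

    module _ {A : Pt → Set} (A? : Decidable A) where

      record Extension {d} (ws : Vec Pt d) (candidates : List Pt) : Set where
        field
          dim              : ℕ
          basis            : Vec Pt dim
          d≤dim            : d ≤ dim
          basis⊆A          : All A basis
          independent      : LinP.LinIndep basis
          spans-ws         : ∀ {u} → InSpan ws u → InSpan basis u
          spans-candidates : ∀ {u} → u ∈ candidates → A u → InSpan basis u
      open Extension

      skip : ∀ {d u us} {ws : Vec Pt d} → (A u → InSpan ws u) → Extension ws us → Extension ws (u ∷ us)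
      skip u∈span E = record
        { dim = dim E ; basis = basis E ; d≤dim = d≤dim E ; basis⊆A = basis⊆A E ; independent = independent E
        ; spans-ws         = spans-ws E
        ; spans-candidates = λ { (here refl) u∈A → spans-ws E (u∈span u∈A) ; (there u∈) → spans-candidates E u∈ } }

      adjoin : ∀ {d u us} {ws : Vec Pt d} → Extension (u ∷ ws) us → Extension ws (u ∷ us)
      adjoin {u = u} {ws = ws} E = record
        { dim = dim E ; basis = basis E ; d≤dim = ℕ.≤-trans (ℕ.n≤1+n _) (d≤dim E)
        ; basis⊆A = basis⊆A E ; independent = independent E
        ; spans-ws         = λ u′∈ → spans-ws E (InSpan-∷ u u′∈)
        ; spans-candidates = λ { (here refl) _ → spans-ws E (InSpan-head u ws) ; (there u′∈) → spans-candidates E u′∈ } }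

      extend : ∀ candidates {d} {ws : Vec Pt d} → All A ws → LinP.LinIndep ws → Extension ws candidates
      extend [] {d} {ws} ws⊆A indep =
        record { dim = d ; basis = ws ; d≤dim = ℕ.≤-refl ; basis⊆A = ws⊆A ; independent = indep
               ; spans-ws = λ u∈ → u∈ ; spans-candidates = λ () }
      extend (u ∷ us) {ws = ws} ws⊆A indep with A? u | InSpan? ws u
      ... | yes u∈A | no u∉span  = adjoin (extend us (u∈A ∷ ws⊆A) (LinIndep-∷ indep u∉span))
      ... | yes _   | yes u∈span = skip (λ _ → u∈span) (extend us ws⊆A indep)
      ... | no u∉A  | _          = skip (λ u∈A → ⊥-elim (u∉A u∈A)) (extend us ws⊆A indep)

      extend-to-basis : ∀ {d} {ws : Vec Pt d} → All A ws → LinP.LinIndep ws → Σ ℕ λ e → d ≤ e × LinP.HasDim A e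
      extend-to-basis ws⊆A indep =
        dim E , d≤dim E , basis E , basis⊆A E , independent E , λ u u∈A → spans-candidates E (allPts-complete u) u∈A
        where
        E : Extension _ allPts
        E = extend allPts ws⊆A indep

    Span? : ∀ v → Decidable (Span v)
    Span? v w = searchable (λ l → w ≟P (l •P v))

    _∩⟨_⟩ : (Pt → Set) → Pt → Pt → Set
    (U ∩⟨ v ⟩) w = U w × Span v w

    IndependentPair : (Pt → Set) → Set
    IndependentPair A = Σ Pt λ w₁ → Σ Pt λ w₂ → A w₁ × A w₂ × LinP.LinIndep (w₁ ∷ w₂ ∷ [])

    Weight≥2⇒IndependentPair : ∀ {U v} → Weight≥2 U v → IndependentPair (U ∩⟨ v ⟩)
    Weight≥2⇒IndependentPair (_ , s≤s (s≤s _) , w₁ ∷ w₂ ∷ _ , w₁∈ ∷ w₂∈ ∷ _ , indep , _) =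
      w₁ , w₂ , w₁∈ , w₂∈ , LinIndep-++⁻ˡ (w₁ ∷ w₂ ∷ []) indep

    IndependentPair⇒Weight≥2 : ∀ {U v} → Decidable U → IndependentPair (U ∩⟨ v ⟩) → Weight≥2 U v
    IndependentPair⇒Weight≥2 {v = v} U? (_ , _ , w₁∈ , w₂∈ , indep) =
      extend-to-basis (λ w → U? w ×-dec Span? v w) (w₁∈ ∷ w₂∈ ∷ []) indep

    SamePoint-axis₁ : ∀ {v w} → SamePoint v w → proj₁ v ≡ 0# → proj₁ w ≡ 0#
    SamePoint-axis₁ {_ , _} (l , refl) v₁≡0 = trans (cong (l *_) v₁≡0) (zeroʳ l)

    SamePoint-axis₂ : ∀ {v w} → SamePoint v w → proj₂ v ≡ 0# → proj₂ w ≡ 0#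
    SamePoint-axis₂ {_ , _} (l , refl) v₂≡0 = trans (cong (l *_) v₂≡0) (zeroʳ l)

    axis₁⇒SamePoint : ∀ {v w} → v ≢ 0P → proj₁ v ≡ 0# → proj₁ w ≡ 0# → SamePoint v w
    axis₁⇒SamePoint {a , b} {c , d} v≢0 a≡0 c≡0 =
      d * b ⁻¹ , cong₂ _,_ (trans c≡0 (sym (trans (cong (_ *_) a≡0) (zeroʳ _)))) (sym (x*y⁻¹*y≡x d b≢0))
      where
      b≢0 : b ≢ 0#
      b≢0 b≡0 = v≢0 (cong₂ _,_ a≡0 b≡0)

    axis₂⇒SamePoint : ∀ {v w} → v ≢ 0P → proj₂ v ≡ 0# → proj₂ w ≡ 0# → SamePoint v w
    axis₂⇒SamePoint {a , b} {c , d} v≢0 b≡0 d≡0 =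
      c * a ⁻¹ , cong₂ _,_ (sym (x*y⁻¹*y≡x c a≢0)) (trans d≡0 (sym (trans (cong (_ *_) b≡0) (zeroʳ _))))
      where
      a≢0 : a ≢ 0#
      a≢0 a≡0 = v≢0 (cong₂ _,_ a≡0 b≡0)

    OnAxes : Pt → Set
    OnAxes v = proj₁ v ≡ 0# ⊎ proj₂ v ≡ 0#

    AtMostTwoHeavyPoints-onAxes : ∀ {U} → (∀ {v} → Weight≥2 U v → OnAxes v) → AtMostTwoHeavyPoints U
    AtMostTwoHeavyPoints-onAxes onAxes v₁ v₂ v₃ v₁≢0 v₂≢0 _ heavy₁ heavy₂ heavy₃
      with onAxes heavy₁ | onAxes heavy₂ | onAxes heavy₃
    ... | inj₁ x₁ | inj₁ x₂ | _       = inj₁ (axis₁⇒SamePoint v₁≢0 x₁ x₂)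
    ... | inj₂ y₁ | inj₂ y₂ | _       = inj₁ (axis₂⇒SamePoint v₁≢0 y₁ y₂)
    ... | inj₁ x₁ | inj₂ _  | inj₁ x₃ = inj₂ (inj₁ (axis₁⇒SamePoint v₁≢0 x₁ x₃))
    ... | inj₂ y₁ | inj₁ _  | inj₂ y₃ = inj₂ (inj₁ (axis₂⇒SamePoint v₁≢0 y₁ y₃))
    ... | inj₁ _  | inj₂ y₂ | inj₂ y₃ = inj₂ (inj₂ (axis₂⇒SamePoint v₂≢0 y₂ y₃))
    ... | inj₂ _  | inj₁ x₂ | inj₁ x₃ = inj₂ (inj₂ (axis₁⇒SamePoint v₂≢0 x₂ x₃))

    TrivialScaledIntersections : (K → Set) → (K → Set) → Set
    TrivialScaledIntersections S T =
      ∀ a₁ a₂ → T a₁ → T a₂ → LinK.LinIndep (a₁ ∷ a₂ ∷ []) → LinK.HasDim (scaleSet a₁ S ∩ scaleSet a₂ S) 0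

    TrivialScaledIntersections⇒onAxes : ∀ {S T} → TrivialScaledIntersections S T → ∀ {v} → Weight≥2 (S ⊠ T) v → OnAxes v
    TrivialScaledIntersections⇒onAxes {S} {T} trivial {a , b} heavy with a ≟ 0# | b ≟ 0#
    ... | yes a≡0 | _       = inj₁ a≡0
    ... | no _    | yes b≡0 = inj₂ b≡0
    ... | no a≢0  | no b≢0  = ⊥-elim (offAxes (Weight≥2⇒IndependentPair heavy))
      where
      offAxes : IndependentPair ((S ⊠ T) ∩⟨ a , b ⟩) → ⊥
      offAxes ((_ , _) , (_ , _) , ((s₁∈ , t₁∈) , l₁ , refl) , ((s₂∈ , t₂∈) , l₂ , refl) , indep) =
        z≢0 (HasDim0⇒≡0 (trivial _ _ t₁∈ t₂∈ indep-t) z∈)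
        where
        indep-l : LinK.LinIndep (l₁ ∷ l₂ ∷ [])
        indep-l = LinIndep-map-•P⁻ (a , b) indep

        indep-t : LinK.LinIndep (l₁ * b ∷ l₂ * b ∷ [])
        indep-t = LinIndep-map-* b≢0 indep-l

        z∈ : (scaleSet (l₁ * b) S ∩ scaleSet (l₂ * b) S) (l₁ * b * (l₂ * a))
        z∈ = (l₂ * a , s₂∈ , refl)
           , (l₁ * a , s₁∈ , solve 4 (λ l₁ l₂ a b → l₁ :* b :* (l₂ :* a) := l₂ :* b :* (l₁ :* a)) refl l₁ l₂ a b)

        z≢0 : l₁ * b * (l₂ * a) ≢ 0#
        z≢0 = x*y≢0 (proj₁ (LinIndep₂⇒≢0 indep-t)) (x*y≢0 (proj₂ (LinIndep₂⇒≢0 indep-l)) a≢0)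

    module _ {S T : K → Set} (S? : Decidable S) (T? : Decidable T) (0∈S : S 0#) (0∈T : T 0#) where
      U? : Decidable (S ⊠ T)
      U? (s , t) = S? s ×-dec T? t

      commonMultiple⇒¬AtMostTwoHeavyPoints : ∀ {a₁ a₂ x} → T a₁ → T a₂ → LinK.LinIndep (a₁ ∷ a₂ ∷ [])
        → (scaleSet a₁ S ∩ scaleSet a₂ S) x → x ≢ 0# → ¬ AtMostTwoHeavyPoints (S ⊠ T)
      commonMultiple⇒¬AtMostTwoHeavyPoints {a₁} {a₂} {x} a₁∈ a₂∈ indep
                                           ((s₁ , s₁∈ , x≡a₁s₁) , (s₂ , s₂∈ , x≡a₂s₂)) x≢0 atMostTwo =
        distinct (atMostTwo e₁ e₂ p (1≢0 ∘ cong proj₁) (1≢0 ∘ cong proj₂) (x≢0 ∘ cong proj₁) heavy₁ heavy₂ heavy₃)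
        where
        e₁ e₂ p : Pt
        e₁ = 1# , 0#
        e₂ = 0# , 1#
        p  = x , a₁ * a₂

        a₁≢0 : a₁ ≢ 0#
        a₁≢0 = proj₁ (LinIndep₂⇒≢0 indep)

        a₂≢0 : a₂ ≢ 0#
        a₂≢0 = proj₂ (LinIndep₂⇒≢0 indep)

        heavy₁ : Weight≥2 (S ⊠ T) e₁
        heavy₁ = IndependentPair⇒Weight≥2 U?
          ( _ , _
          , ((s₂∈ , 0∈T) , s₂ , cong₂ _,_ (sym (*-identityʳ s₂)) (sym (zeroʳ s₂)))
          , ((s₁∈ , 0∈T) , s₁ , cong₂ _,_ (sym (*-identityʳ s₁)) (sym (zeroʳ s₁)))
          , LinIndep-proj₁ (commonMultiple⇒LinIndep indep (trans (sym x≡a₁s₁) x≡a₂s₂) (x≢0 ∘ trans x≡a₁s₁)))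

        heavy₂ : Weight≥2 (S ⊠ T) e₂
        heavy₂ = IndependentPair⇒Weight≥2 U?
          ( _ , _
          , ((0∈S , a₁∈) , a₁ , cong₂ _,_ (sym (zeroʳ a₁)) (sym (*-identityʳ a₁)))
          , ((0∈S , a₂∈) , a₂ , cong₂ _,_ (sym (zeroʳ a₂)) (sym (*-identityʳ a₂)))
          , LinIndep-proj₂ indep)

        heavy₃ : Weight≥2 (S ⊠ T) p
        heavy₃ = IndependentPair⇒Weight≥2 U?
          ( _ , _
          , ((s₂∈ , a₁∈) , a₂ ⁻¹
            , cong₂ _,_ (y≡x*z⇒z≡x⁻¹*y a₂≢0 x≡a₂s₂) (y≡x*z⇒z≡x⁻¹*y a₂≢0 (*-comm a₁ a₂)))
          , ((s₁∈ , a₂∈) , a₁ ⁻¹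
            , cong₂ _,_ (y≡x*z⇒z≡x⁻¹*y a₁≢0 x≡a₁s₁) (y≡x*z⇒z≡x⁻¹*y a₁≢0 refl))
          , LinIndep-proj₂ indep)

        distinct : SamePoint e₁ e₂ ⊎ SamePoint e₁ p ⊎ SamePoint e₂ p → ⊥
        distinct (inj₁ same)        = 1≢0 (SamePoint-axis₂ same refl)
        distinct (inj₂ (inj₁ same)) = x*y≢0 a₁≢0 a₂≢0 (SamePoint-axis₂ same refl)
        distinct (inj₂ (inj₂ same)) = x≢0 (SamePoint-axis₁ same refl)

      AtMostTwoHeavyPoints⇒TrivialScaledIntersections : AtMostTwoHeavyPoints (S ⊠ T) → TrivialScaledIntersections S T
      AtMostTwoHeavyPoints⇒TrivialScaledIntersections atMostTwo a₁ a₂ a₁∈ a₂∈ indep = ≡0⇒HasDim0 λ {x} x∈ →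
        decidable-stable (x ≟ 0#) (λ x≢0 → commonMultiple⇒¬AtMostTwoHeavyPoints a₁∈ a₂∈ indep x∈ x≢0 atMostTwo)

    AtMostTwoHeavyPoints⇔TrivialScaledIntersections : ∀ {S T dS dT}
      → LinK.Subspace S → LinK.HasDim S dS → LinK.Subspace T → LinK.HasDim T dT
      → AtMostTwoHeavyPoints (S ⊠ T) ⇔ TrivialScaledIntersections S T
    AtMostTwoHeavyPoints⇔TrivialScaledIntersections S-subspace S-basis T-subspace T-basis = mk⇔
      (AtMostTwoHeavyPoints⇒TrivialScaledIntersections (HasDim⇒Decidable S-subspace S-basis)
        (HasDim⇒Decidable T-subspace T-basis) (proj₁ S-subspace) (proj₁ T-subspace))
      (λ trivial → AtMostTwoHeavyPoints-onAxes (TrivialScaledIntersections⇒onAxes trivial))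

corollary3p5 : (q n k r : ℕ) → IsPrimePower q → 1 ≤ n → 1 ≤ k → 1 ≤ r
    → (𝔽 : FiniteField) → FiniteField.card 𝔽 ≡ q ^ n
    → let open OverField 𝔽 q in
      (S T : FiniteField.K 𝔽 → Set)
    → LinK.Subspace S → LinK.HasDim S (k ∸ r)
    → LinK.Subspace T → LinK.HasDim T r
    → r ≤ k ∸ r
    → AtMostTwoHeavyPoints (S ⊠ T)
      ⇔ (∀ a₁ a₂ → T a₁ → T a₂ → LinK.LinIndep (a₁ ∷ a₂ ∷ [])
           → LinK.HasDim (scaleSet a₁ S ∩ scaleSet a₂ S) 0)
corollary3p5 _       zero    _ _ _ () _ _ _ _
corollary3p5 zero    (suc n) _ _ _ _ _ _ 𝔽 card≡0 = ⊥-elim (FieldLemmas.card≢0 𝔽 card≡0)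
corollary3p5 (suc q) (suc n) _ _ _ _ _ _ 𝔽 card≡q^n S T S-subspace S-basis T-subspace T-basis _ =
  Subfield.AtMostTwoHeavyPoints⇔TrivialScaledIntersections 𝔽 (suc q) (FieldLemmas.pow-[-1]≡-1 𝔽 {suc q} {n} card≡q^n)
    S-subspace S-basis T-subspace T-basis
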